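{- Let $i,j\ge 1$, and let $P=\{p_1<p_2<\dots<p_r\}\subseteq\{1,\dots,i\}$ with $r\le j$. Let $\mathcal{G}^i_j(P)$ be the set of all matchings of $\mathcal{G}^i_j$ of the form $M=\{a_{p_1}b_{q_1},\dots,a_{p_r}b_{q_r}\}$, where $(q_1,\dots,q_r)$ ranges over tuples of pairwise distinct elements of $\{1,\dots,j\}$. Then \[ \sum_{M\in\mathcal{G}^i_j(P)}\operatorname{wt}(M)=\prod_{s=1}^r\bigl(t_{p_s}-t_{p_s+j+1-s}\bigr). \]
   Context: $t_1,t_2,\dots$ are indeterminates and $\beta_m:=t_m-t_{m+1}$. The graph $\mathcal{G}^i_j$ is the complete bipartite graph on vertex sets $A=\{a_1,\dots,a_i\}$ and $B=\{b_1,\dots,b_j\}$; a matching is a set of pairwise vertex-disjoint edges $a_gb_h$. For an edge $e=a_gb_h$ of a matching $M$, its crossing value is $X(e)=\#\{a_pb_q\in M: p<g,\ q<h\}$, its weight is $\operatorname{wt}(e)=g+h-X(e)-1$, and $\operatorname{wt}(M)=\prod_{e\in M}\beta_{\operatorname{wt}(e)}$. -}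

module Defs where

open import Level using (Level)
open import Algebra.Bundles using (CommutativeRing)
open import Data.Nat using (ℕ; zero; suc; _+_; _∸_; _<?_)
open import Data.Nat.Properties using (_≟_)
open import Data.Product using (_×_; _,_; proj₁; proj₂)
open import Data.List using (List; []; _∷_; map; concatMap; filter; length; zip; upTo; foldr)
open import Data.List.Relation.Unary.Unique.Propositional using (Unique)
open import Data.List.Relation.Unary.Unique.DecPropositional _≟_ using (unique?)
open import Relation.Nullary.Decidable using (_×-dec_)

-- An edge a_g b_h of the complete bipartite graph is the pair (g , h) (1-based indices).
Edge : Set
Edge = ℕ × ℕ

Matching : Set
Matching = List Edge

crossing : Matching → Edge → ℕ
crossing M (g , h) = length (filter (λ e → (proj₁ e <? g) ×-dec (proj₂ e <? h)) M)

-- wt(e) = g + h - X(e) - 1   (always ≥ 1, so truncated subtraction is exact).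
edgeWt : Matching → Edge → ℕ
edgeWt M (g , h) = g + h ∸ crossing M (g , h) ∸ 1

tuples : ℕ → ℕ → List (List ℕ)
tuples zero    j = [] ∷ []
tuples (suc r) j = concatMap (λ q → map (q ∷_) (tuples r j)) (map suc (upTo j))

distinctTuples : ℕ → ℕ → List (List ℕ)
distinctTuples r j = filter unique? (tuples r j)

-- 𝒢^i_j(P): matchings {a_{p_1} b_{q_1}, …, a_{p_r} b_{q_r}}, P given as the increasing list p_1 < … < p_r.
matchingsP : List ℕ → ℕ → List Matching
matchingsP P j = map (zip P) (distinctTuples (length P) j)

module _ {c ℓ : Level} (R : CommutativeRing c ℓ) (t : ℕ → CommutativeRing.Carrier R) where
  open CommutativeRing R renaming (_+_ to _+R_; _*_ to _*R_; _-_ to _-R_)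

  β : ℕ → Carrier
  β m = t m -R t (suc m)

  prodR : List Carrier → Carrier
  prodR = foldr _*R_ 1#

  sumR : List Carrier → Carrier
  sumR = foldr _+R_ 0#

  wt : Matching → Carrier
  wt M = prodR (map (λ e → β (edgeWt M e)) M)

  lhsSum : List ℕ → ℕ → Carrier
  lhsSum P j = sumR (map wt (matchingsP P j))

  rhsFrom : ℕ → ℕ → List ℕ → Carrier
  rhsFrom j s []       = 1#
  rhsFrom j s (p ∷ ps) = (t p -R t (p + j + 1 ∸ s)) *R rhsFrom j (suc s) ps

  rhsProd : List ℕ → ℕ → Carrier
  rhsProd P j = rhsFrom j 1 P

-- Fix a prefix C of edges already placed in rows above P, using the distinct columns D. An edge
-- a_p b_q is crossed exactly by the edges of earlier rows in columns below q, so its weight depends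
-- only on the prefix: it is p + q - 1 - #{d ∈ D : d < q}. Summing first over the column q of the
-- first row of P therefore factors the sum, and as q runs through the columns outside D in
-- increasing order, q - #{d ∈ D : d < q} runs through 1, 2, …, j - |D|; so the β's telescope to
-- t_p - t_{p + j - |D|}, which is the factor of the product for s = |D| + 1.
module Submission where

open import Defs
open import Level using (Level)
open import Algebra.Bundles using (CommutativeRing; Semiring)
open import Data.Nat using (ℕ; zero; suc; _+_; _∸_; _≤_; _<_; _<?_; z≤n; s≤s; s≤s⁻¹)
open import Data.Nat.Properties using (_≟_)
import Data.Nat.Properties as ℕ
open import Data.Nat.Tactic.RingSolver using (solve-∀)
open import Data.Product using (_×_; _,_; proj₁; proj₂)
open import Data.List using (List; []; _∷_; _++_; [_]; _∷ʳ_; map; filter; length; zip; upTo; concatMap; foldr)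
open import Data.List.Properties
  using (map-∘; map-cong; map-++; length-map; length-++; ++-identityʳ; ∷ʳ-++; upTo-∷ʳ;
         filter-++; filter-none; filter-accept; filter-reject; filter-≐)
open import Data.List.Relation.Unary.All as All using (All; []; _∷_)
open import Data.List.Relation.Unary.AllPairs using (AllPairs; []; _∷_)
import Data.List.Relation.Unary.All.Properties as All
open import Data.List.Relation.Unary.Any using (here; there)
open import Data.List.Relation.Unary.Linked using (Linked)
open import Data.List.Relation.Unary.Linked.Properties using (Linked⇒AllPairs)
open import Data.List.Membership.Propositional using (_∈_; _∉_)
open import Data.List.Membership.Propositional.Properties using (∈-++⁺ʳ)
open import Data.List.Membership.DecPropositional _≟_ using (_∈?_)
open import Data.List.Relation.Unary.Unique.Propositional using (Unique)
import Data.List.Relation.Unary.Unique.Propositional.Properties as Unique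
open import Data.List.Relation.Unary.Unique.DecPropositional _≟_ using (unique?)
open import Function using (_∘_; id)
open import Relation.Nullary using (_×-dec_; yes; no; ¬_; contradiction)
open import Relation.Unary using (Decidable)
open import Relation.Binary.PropositionalEquality
  using (_≡_; refl; sym; trans; cong; cong₂; subst; module ≡-Reasoning)

All-zip⁺ˡ : ∀ {P : ℕ → Set} {ps} (qs : List ℕ) → All P ps → All (P ∘ proj₁) (zip ps qs)
All-zip⁺ˡ _        []         = []
All-zip⁺ˡ []       (_ ∷ _)    = []
All-zip⁺ˡ (_ ∷ qs) (Pp ∷ Pps) = Pp ∷ All-zip⁺ˡ qs Pps

filter-map : ∀ {A B : Set} {P : B → Set} (P? : Decidable P) (f : A → B) xs →
             filter P? (map f xs) ≡ map f (filter (P? ∘ f) xs)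
filter-map P? f [] = refl
filter-map P? f (x ∷ xs) with P? (f x)
... | yes _ = cong (f x ∷_) (filter-map P? f xs)
... | no  _ = filter-map P? f xs

∈⇒¬Unique-++-∷ : ∀ {A : Set} {xs : List A} {x} ys → x ∈ xs → ¬ Unique (xs ++ x ∷ ys)
∈⇒¬Unique-++-∷ {xs = _ ∷ xs} ys (here refl) (x∉ ∷ _) =
  All.lookup x∉ (∈-++⁺ʳ xs (here refl)) refl
∈⇒¬Unique-++-∷ {xs = _ ∷ xs} ys (there x∈xs) (_ ∷ uniq) = ∈⇒¬Unique-++-∷ ys x∈xs uniq

m+suc[n+o]∸n∸1≡m+o : ∀ m n o → m + suc (n + o) ∸ n ∸ 1 ≡ m + o
m+suc[n+o]∸n∸1≡m+o m n o = begin
  m + suc (n + o) ∸ n ∸ 1   ≡⟨ ℕ.∸-+-assoc (m + suc (n + o)) n 1 ⟩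
  m + suc (n + o) ∸ (n + 1) ≡⟨ cong (_∸ (n + 1)) (rearrange m n o) ⟩
  m + o + (n + 1) ∸ (n + 1) ≡⟨ ℕ.m+n∸n≡m (m + o) (n + 1) ⟩
  m + o                     ∎
  where
  open ≡-Reasoning
  rearrange : ∀ m n o → m + suc (n + o) ≡ m + o + (n + 1)
  rearrange = solve-∀

m+[n+o]+1∸suc[n]≡m+o : ∀ m n o → m + (n + o) + 1 ∸ suc n ≡ m + o
m+[n+o]+1∸suc[n]≡m+o m n o = trans (cong (_∸ suc n) (rearrange m n o)) (ℕ.m+n∸n≡m (m + o) (suc n))
  where
  rearrange : ∀ m n o → m + (n + o) + 1 ≡ m + o + suc n
  rearrange = solve-∀

countBelow : ℕ → List ℕ → ℕ
countBelow q [] = 0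
countBelow q (u ∷ D) with u <? q
... | yes _ = suc (countBelow q D)
... | no  _ = countBelow q D

countBelow-suc-∉ : ∀ {q} D → q ∉ D → countBelow (suc q) D ≡ countBelow q D
countBelow-suc-∉ [] _ = refl
countBelow-suc-∉ {q} (u ∷ D) q∉ with u <? suc q | u <? q
... | yes _   | yes _   = cong suc (countBelow-suc-∉ D (q∉ ∘ there))
... | no  u≮q | yes u<q = contradiction (ℕ.m<n⇒m<1+n u<q) u≮q
... | yes u≤q | no  u≮q = contradiction (here (sym (ℕ.≤∧≮⇒≡ (s≤s⁻¹ u≤q) u≮q))) q∉
... | no  _   | no  _   = countBelow-suc-∉ D (q∉ ∘ there)

countBelow-suc-∈ : ∀ {q} D → Unique D → q ∈ D → countBelow (suc q) D ≡ suc (countBelow q D)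
countBelow-suc-∈ {q} (u ∷ D) (u∉D ∷ uniq) q∈ with u <? suc q | u <? q | q∈
... | _       | yes u<q | here refl = contradiction u<q (ℕ.<-irrefl refl)
... | yes _   | no _    | here refl = cong suc (countBelow-suc-∉ D (λ q∈D → All.lookup u∉D q∈D refl))
... | no u≮q  | _       | here refl = contradiction ℕ.≤-refl u≮q
... | yes _   | yes _   | there q∈D = cong suc (countBelow-suc-∈ D uniq q∈D)
... | no u≮q  | yes u<q | there _   = contradiction (ℕ.m<n⇒m<1+n u<q) u≮q
... | yes u≤q | no u≮q  | there q∈D = contradiction (ℕ.≤∧≮⇒≡ (s≤s⁻¹ u≤q) u≮q) (All.lookup u∉D q∈D)
... | no _    | no _    | there q∈D = countBelow-suc-∈ D uniq q∈D

countBelow-1 : ∀ {D} → All (1 ≤_) D → countBelow 1 D ≡ 0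
countBelow-1 [] = refl
countBelow-1 {u ∷ D} (1≤u ∷ pos) with u <? 1
... | yes u<1 = contradiction (ℕ.<-≤-trans u<1 1≤u) (ℕ.<-irrefl refl)
... | no  _   = countBelow-1 pos

countBelow-bounded : ∀ {j D} → All (_≤ j) D → countBelow (suc j) D ≡ length D
countBelow-bounded [] = refl
countBelow-bounded {j} {u ∷ D} (u≤j ∷ bnd) with u <? suc j
... | yes _   = cong suc (countBelow-bounded bnd)
... | no  u≮j = contradiction (s≤s u≤j) u≮j

countFree : ℕ → List ℕ → ℕ
countFree zero    D = 0
countFree (suc n) D with suc n ∈? D
... | yes _ = countFree n D
... | no  _ = suc (countFree n D)

countBelow+countFree : ∀ {D} → Unique D → All (1 ≤_) D →
                       ∀ n → countBelow (suc n) D + countFree n D ≡ n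
countBelow+countFree uniq pos zero = cong (_+ 0) (countBelow-1 pos)
countBelow+countFree {D} uniq pos (suc n) with suc n ∈? D
... | yes sn∈D = trans (cong (_+ countFree n D) (countBelow-suc-∈ D uniq sn∈D))
                       (cong suc (countBelow+countFree uniq pos n))
... | no  sn∉D = trans (cong (_+ suc (countFree n D)) (countBelow-suc-∉ D sn∉D))
                       (trans (ℕ.+-suc _ _) (cong suc (countBelow+countFree uniq pos n)))

InRange : ℕ → ℕ → Set
InRange j q = 1 ≤ q × q ≤ j

length+countFree : ∀ {j D} → Unique D → All (InRange j) D → length D + countFree j D ≡ j
length+countFree {j} {D} uniq inRange =
  trans (cong (_+ countFree j D) (sym (countBelow-bounded (All.map proj₂ inRange))))
        (countBelow+countFree uniq (All.map proj₁ inRange) j)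

before? : (e : Edge) → Decidable (λ e′ → proj₁ e′ < proj₁ e × proj₂ e′ < proj₂ e)
before? (g , h) e′ = (proj₁ e′ <? g) ×-dec (proj₂ e′ <? h)

crossing-++ : ∀ C M e → crossing (C ++ M) e ≡ crossing C e + crossing M e
crossing-++ C M e =
  trans (cong length (filter-++ (before? e) C M)) (length-++ (filter (before? e) C))

crossing-below : ∀ {p q} C → All (λ e → proj₁ e < p) C →
                 crossing C (p , q) ≡ countBelow q (map proj₂ C)
crossing-below [] [] = refl
crossing-below {p} {q} ((a , b) ∷ C) (a<p ∷ C<p) with b <? q
... | yes b<q = trans (cong length (filter-accept (before? (p , q)) {xs = C} (a<p , b<q)))
                      (cong suc (crossing-below C C<p))
... | no  b≮q = trans (cong length (filter-reject (before? (p , q)) {xs = C} (b≮q ∘ proj₂)))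
                      (crossing-below C C<p)

crossing-above : ∀ {p q} M → All (λ e → p ≤ proj₁ e) M → crossing M (p , q) ≡ 0
crossing-above {p} {q} M p≤M =
  cong length (filter-none (before? (p , q)) (All.map (λ p≤a (a<p , _) → ℕ.<⇒≱ a<p p≤a) p≤M))

crossing-pivot : ∀ {p q} C M → All (λ e → proj₁ e < p) C → All (λ e → p ≤ proj₁ e) M →
                 crossing (C ++ M) (p , q) ≡ countBelow q (map proj₂ C)
crossing-pivot C M C<p p≤M =
  trans (crossing-++ C M _)
        (trans (cong₂ _+_ (crossing-below C C<p) (crossing-above M p≤M)) (ℕ.+-identityʳ _))

RowsBelow : Matching → List ℕ → Set
RowsBelow C P = All (λ e → All (proj₁ e <_) P) C

fresh? : (D : List ℕ) → Decidable (λ qs → Unique (D ++ qs))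
fresh? D qs = unique? (D ++ qs)

freshTuples : List ℕ → ℕ → ℕ → List (List ℕ)
freshTuples D r j = filter (fresh? D) (tuples r j)

filter-fresh-∷ : ∀ D q (T : List (List ℕ)) →
                 filter (fresh? D) (map (q ∷_) T) ≡ map (q ∷_) (filter (fresh? (D ∷ʳ q)) T)
filter-fresh-∷ D q T = trans (filter-map _ (q ∷_) T) (cong (map (q ∷_)) (filter-≐ _ _ same T))
  where
  same = (λ {qs} → subst Unique (sym (∷ʳ-++ D q qs))) , (λ {qs} → subst Unique (∷ʳ-++ D q qs))

filter-fresh-∈ : ∀ {D q} (T : List (List ℕ)) → q ∈ D → filter (fresh? (D ∷ʳ q)) T ≡ []
filter-fresh-∈ {D} {q} T q∈D =
  filter-none (fresh? (D ∷ʳ q)) {T}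
    (All.tabulate (λ {qs} _ → ∈⇒¬Unique-++-∷ qs q∈D ∘ subst Unique (∷ʳ-++ D q qs)))

module ListSum {c ℓ} (S : Semiring c ℓ) where
  open Semiring S
    renaming (_+_ to _+R_; _*_ to _*R_; refl to ≈-refl; sym to ≈-sym; trans to ≈-trans)
  open import Relation.Binary.Reasoning.Setoid setoid

  sum : List Carrier → Carrier
  sum = foldr _+R_ 0#

  sum-++ : ∀ xs ys → sum (xs ++ ys) ≈ sum xs +R sum ys
  sum-++ []       ys = ≈-sym (+-identityˡ _)
  sum-++ (x ∷ xs) ys = ≈-trans (+-congˡ (sum-++ xs ys)) (≈-sym (+-assoc _ _ _))

  sum-∷ʳ : ∀ xs x → sum (xs ∷ʳ x) ≈ sum xs +R x
  sum-∷ʳ xs x = ≈-trans (sum-++ xs [ x ]) (+-congˡ (+-identityʳ x))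

  sum-map-cong : ∀ {A : Set} {f g : A → Carrier} {xs} →
                 All (λ x → f x ≈ g x) xs → sum (map f xs) ≈ sum (map g xs)
  sum-map-cong []           = ≈-refl
  sum-map-cong (fx≈gx ∷ eq) = +-cong fx≈gx (sum-map-cong eq)

  *-distribˡ-sum : ∀ {A : Set} k (f : A → Carrier) xs →
                   sum (map (λ x → k *R f x) xs) ≈ k *R sum (map f xs)
  *-distribˡ-sum k f []       = ≈-sym (zeroʳ k)
  *-distribˡ-sum k f (x ∷ xs) = ≈-trans (+-congˡ (*-distribˡ-sum k f xs)) (≈-sym (distribˡ k _ _))

  *-distribʳ-sum : ∀ {A : Set} k (f : A → Carrier) xs →
                   sum (map (λ x → f x *R k) xs) ≈ sum (map f xs) *R k
  *-distribʳ-sum k f []       = ≈-sym (zeroˡ k)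
  *-distribʳ-sum k f (x ∷ xs) = ≈-trans (+-congˡ (*-distribʳ-sum k f xs)) (≈-sym (distribʳ k _ _))

  sum-filter-concatMap : ∀ {A B : Set} {P : B → Set} (P? : Decidable P) (g : B → Carrier) (f : A → List B) xs →
                         sum (map g (filter P? (concatMap f xs)))
                           ≈ sum (map (λ x → sum (map g (filter P? (f x)))) xs)
  sum-filter-concatMap P? g f []       = ≈-refl
  sum-filter-concatMap P? g f (x ∷ xs) = begin
    sum (map g (filter P? (f x ++ concatMap f xs)))
      ≡⟨ cong (sum ∘ map g) (filter-++ P? (f x) (concatMap f xs)) ⟩
    sum (map g (filter P? (f x) ++ filter P? (concatMap f xs)))
      ≡⟨ cong sum (map-++ g (filter P? (f x)) _) ⟩
    sum (map g (filter P? (f x)) ++ map g (filter P? (concatMap f xs)))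
      ≈⟨ sum-++ (map g (filter P? (f x))) _ ⟩
    sum (map g (filter P? (f x))) +R sum (map g (filter P? (concatMap f xs)))
      ≈⟨ +-congˡ (sum-filter-concatMap P? g f xs) ⟩
    sum (map g (filter P? (f x))) +R sum (map (λ x → sum (map g (filter P? (f x)))) xs) ∎

module _ {c ℓ : Level} (R : CommutativeRing c ℓ) (t : ℕ → CommutativeRing.Carrier R) where
  open CommutativeRing R
    renaming (_+_ to _+R_; _*_ to _*R_; _-_ to _-R_; refl to ≈-refl; sym to ≈-sym; trans to ≈-trans)
    hiding (zero)
  open ListSum semiring
  open import Relation.Binary.Reasoning.Setoid setoid

  [x-y]+[y-z]≈x-z : ∀ x y z → (x -R y) +R (y -R z) ≈ x -R z
  [x-y]+[y-z]≈x-z x y z = begin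
    (x -R y) +R (y -R z)   ≈⟨ +-assoc x (- y) (y -R z) ⟩
    x +R (- y +R (y -R z)) ≈⟨ +-congˡ (≈-sym (+-assoc (- y) y (- z))) ⟩
    x +R (- y +R y -R z)   ≈⟨ +-congˡ (+-congʳ (-‿inverseˡ y)) ⟩
    x +R (0# -R z)         ≈⟨ +-congˡ (+-identityˡ (- z)) ⟩
    x -R z                 ∎

  columnWt : List ℕ → ℕ → ℕ → Carrier
  columnWt D p q with q ∈? D
  ... | yes _ = 0#
  ... | no  _ = β R t (p + q ∸ countBelow q D ∸ 1)

  sum-columnWt : ∀ {D} p → Unique D → All (1 ≤_) D → ∀ n →
                 sum (map (columnWt D p) (map suc (upTo n))) ≈ t p -R t (p + countFree n D)
  sum-columnWt p uniq pos zero = begin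
    0#               ≈⟨ ≈-sym (-‿inverseʳ (t p)) ⟩
    t p -R t p       ≡⟨ cong (λ m → t p -R t m) (sym (ℕ.+-identityʳ p)) ⟩
    t p -R t (p + 0) ∎
  sum-columnWt {D} p uniq pos (suc n) = begin
    sum (map (columnWt D p) (map suc (upTo (suc n))))
      ≡⟨ cong (sum ∘ map (columnWt D p)) (map-suc-upTo-suc n) ⟩
    sum (map (columnWt D p) (map suc (upTo n) ∷ʳ suc n))
      ≡⟨ cong sum (map-++ (columnWt D p) (map suc (upTo n)) [ suc n ]) ⟩
    sum (map (columnWt D p) (map suc (upTo n)) ∷ʳ columnWt D p (suc n))
      ≈⟨ sum-∷ʳ (map (columnWt D p) (map suc (upTo n))) _ ⟩
    sum (map (columnWt D p) (map suc (upTo n))) +R columnWt D p (suc n)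
      ≈⟨ +-congʳ (sum-columnWt p uniq pos n) ⟩
    (t p -R t (p + countFree n D)) +R columnWt D p (suc n)
      ≈⟨ lastColumn ⟩
    t p -R t (p + countFree (suc n) D) ∎
    where
    map-suc-upTo-suc : ∀ n → map suc (upTo (suc n)) ≡ map suc (upTo n) ∷ʳ suc n
    map-suc-upTo-suc n = trans (cong (map suc) (sym (upTo-∷ʳ n))) (map-++ suc (upTo n) [ n ])

    index : p + suc n ∸ countBelow (suc n) D ∸ 1 ≡ p + countFree n D
    index = trans (cong (λ m → p + suc m ∸ countBelow (suc n) D ∸ 1) (sym (countBelow+countFree uniq pos n)))
                  (m+suc[n+o]∸n∸1≡m+o p (countBelow (suc n) D) (countFree n D))

    lastColumn : (t p -R t (p + countFree n D)) +R columnWt D p (suc n) ≈ t p -R t (p + countFree (suc n) D)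
    lastColumn with suc n ∈? D
    ... | yes _ = +-identityʳ _
    ... | no  _ = begin
      (t p -R t (p + countFree n D)) +R β R t (p + suc n ∸ countBelow (suc n) D ∸ 1)
        ≡⟨ cong (λ m → (t p -R t (p + countFree n D)) +R β R t m) index ⟩
      (t p -R t (p + countFree n D)) +R (t (p + countFree n D) -R t (suc (p + countFree n D)))
        ≈⟨ [x-y]+[y-z]≈x-z (t p) _ _ ⟩
      t p -R t (suc (p + countFree n D))
        ≡⟨ cong (λ m → t p -R t m) (sym (ℕ.+-suc p (countFree n D))) ⟩
      t p -R t (p + suc (countFree n D)) ∎

  extensionWt : Matching → List ℕ → List ℕ → Carrier
  extensionWt C P qs = prodR R t (map (λ e → β R t (edgeWt (C ++ zip P qs) e)) (zip P qs))

  extensionWt-∷ : ∀ {p q} C P qs → All (λ e → proj₁ e < p) C → All (p <_) P →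
                  extensionWt C (p ∷ P) (q ∷ qs)
                    ≡ β R t (p + q ∸ countBelow q (map proj₂ C) ∸ 1) *R extensionWt (C ∷ʳ (p , q)) P qs
  extensionWt-∷ {p} {q} C P qs C<p p<P = cong₂ _*R_
    (cong (λ x → β R t (p + q ∸ x ∸ 1)) (crossing-pivot C ((p , q) ∷ zip P qs) C<p p≤rest))
    (cong (λ M → prodR R t (map (λ e → β R t (edgeWt M e)) (zip P qs))) (sym (∷ʳ-++ C (p , q) (zip P qs))))
    where
    p≤rest : All (λ e → p ≤ proj₁ e) ((p , q) ∷ zip P qs)
    p≤rest = ℕ.≤-refl ∷ All.map ℕ.<⇒≤ (All-zip⁺ˡ qs p<P)

  sum-extensionWt-column : ∀ {j p q K} C P → All (λ e → proj₁ e < p) C → All (p <_) P →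
    (q ∉ map proj₂ C →
       sum (map (extensionWt (C ∷ʳ (p , q)) P) (freshTuples (map proj₂ C ∷ʳ q) (length P) j)) ≈ K) →
    sum (map (extensionWt C (p ∷ P)) (filter (fresh? (map proj₂ C)) (map (q ∷_) (tuples (length P) j))))
      ≈ columnWt (map proj₂ C) p q *R K
  sum-extensionWt-column {j} {p} {q} {K} C P C<p p<P rest = begin
    sum (map W (filter (fresh? D) (map (q ∷_) T)))
      ≡⟨ cong (sum ∘ map W) (filter-fresh-∷ D q T) ⟩
    sum (map W (map (q ∷_) X))
      ≡⟨ cong sum (sym (map-∘ X)) ⟩
    sum (map (W ∘ (q ∷_)) X)
      ≡⟨ cong sum (map-cong (λ qs → extensionWt-∷ C P qs C<p p<P) X) ⟩
    sum (map (λ qs → b *R W′ qs) X)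
      ≈⟨ *-distribˡ-sum b W′ X ⟩
    b *R sum (map W′ X)
      ≈⟨ byColumn ⟩
    columnWt D p q *R K ∎
    where
    D = map proj₂ C
    T = tuples (length P) j
    X = freshTuples (D ∷ʳ q) (length P) j
    W = extensionWt C (p ∷ P)
    W′ = extensionWt (C ∷ʳ (p , q)) P
    b = β R t (p + q ∸ countBelow q D ∸ 1)

    byColumn : b *R sum (map W′ X) ≈ columnWt D p q *R K
    byColumn with q ∈? D
    ... | no  q∉D = *-congˡ (rest q∉D)
    ... | yes q∈D = begin
      b *R sum (map W′ X) ≡⟨ cong (λ Y → b *R sum (map W′ Y)) (filter-fresh-∈ T q∈D) ⟩
      b *R 0#             ≈⟨ zeroʳ b ⟩
      0#                  ≈⟨ ≈-sym (zeroˡ K) ⟩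
      0# *R K             ∎

  sum-extensionWt : ∀ j P C → AllPairs _<_ P → RowsBelow C P →
                    Unique (map proj₂ C) → All (InRange j) (map proj₂ C) →
                    sum (map (extensionWt C P) (freshTuples (map proj₂ C) (length P) j))
                      ≈ rhsFrom R t j (suc (length C)) P
  sum-extensionWt j [] C [] _ uniq _ = begin
    sum (map (extensionWt C []) (filter (fresh? (map proj₂ C)) ([] ∷ [])))
      ≡⟨ cong (sum ∘ map (extensionWt C [])) (filter-accept (fresh? (map proj₂ C)) uniq++[]) ⟩
    1# +R 0#
      ≈⟨ +-identityʳ 1# ⟩
    1# ∎
    where uniq++[] = subst Unique (sym (++-identityʳ _)) uniq
  sum-extensionWt j (p ∷ P) C (p<P ∷ sorted) rowsBelow uniq inRange = begin
    sum (map W (filter (fresh? D) (concatMap (λ q → map (q ∷_) T) columns)))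
      ≈⟨ sum-filter-concatMap (fresh? D) W (λ q → map (q ∷_) T) columns ⟩
    sum (map (λ q → sum (map W (filter (fresh? D) (map (q ∷_) T)))) columns)
      ≈⟨ sum-map-cong (All.map (λ q-range → sum-extensionWt-column C P C<p p<P (recurse q-range)) columns-InRange) ⟩
    sum (map (λ q → columnWt D p q *R K) columns)
      ≈⟨ *-distribʳ-sum K (columnWt D p) columns ⟩
    sum (map (columnWt D p) columns) *R K
      ≈⟨ *-congʳ (sum-columnWt p uniq (All.map proj₁ inRange) j) ⟩
    (t p -R t (p + countFree j D)) *R K
      ≡⟨ cong (λ m → (t p -R t m) *R K) (sym index) ⟩
    rhsFrom R t j (suc (length C)) (p ∷ P) ∎
    where
    D = map proj₂ C
    T = tuples (length P) j
    W = extensionWt C (p ∷ P)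
    K = rhsFrom R t j (suc (suc (length C))) P
    columns = map suc (upTo j)
    C<p = All.map All.head rowsBelow

    columns-InRange : All (InRange j) columns
    columns-InRange = All.map⁺ (All.applyUpTo⁺₁ id j (λ i<j → s≤s z≤n , i<j))

    index : p + j + 1 ∸ suc (length C) ≡ p + countFree j D
    index = trans (cong (λ m → p + m + 1 ∸ suc (length C)) (sym j≡))
                  (m+[n+o]+1∸suc[n]≡m+o p (length C) (countFree j D))
      where
      j≡ : length C + countFree j D ≡ j
      j≡ = trans (cong (_+ countFree j D) (sym (length-map proj₂ C))) (length+countFree uniq inRange)

    recurse : ∀ {q} → InRange j q → q ∉ D →
              sum (map (extensionWt (C ∷ʳ (p , q)) P) (freshTuples (D ∷ʳ q) (length P) j)) ≈ K
    recurse {q} q-range q∉D = begin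
      sum (map (extensionWt C′ P) (freshTuples (D ∷ʳ q) (length P) j))
        ≡⟨ cong (λ D′ → sum (map (extensionWt C′ P) (freshTuples D′ (length P) j))) (sym columns-∷ʳ) ⟩
      sum (map (extensionWt C′ P) (freshTuples (map proj₂ C′) (length P) j))
        ≈⟨ sum-extensionWt j P C′ sorted rowsBelow′ uniq′ inRange′ ⟩
      rhsFrom R t j (suc (length C′)) P
        ≡⟨ cong (λ k → rhsFrom R t j (suc k) P) (trans (length-++ C) (ℕ.+-comm (length C) 1)) ⟩
      K ∎
      where
      C′ = C ∷ʳ (p , q)
      columns-∷ʳ : map proj₂ C′ ≡ D ∷ʳ q
      columns-∷ʳ = map-++ proj₂ C [ (p , q) ]
      rowsBelow′ : RowsBelow C′ P
      rowsBelow′ = All.++⁺ (All.map All.tail rowsBelow) (p<P ∷ [])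
      uniq′ : Unique (map proj₂ C′)
      uniq′ = subst Unique (sym columns-∷ʳ) (Unique.++⁺ uniq ([] ∷ []) λ { (q∈D , here refl) → q∉D q∈D })
      inRange′ : All (InRange j) (map proj₂ C′)
      inRange′ = subst (All (InRange j)) (sym columns-∷ʳ) (All.++⁺ inRange (q-range ∷ []))

lemma2p4 : ∀ {c ℓ : Level} (R : CommutativeRing c ℓ) (t : ℕ → CommutativeRing.Carrier R)
           (i j : ℕ) → 1 ≤ i → 1 ≤ j →
           (P : List ℕ) → Linked _<_ P → All (λ p → 1 ≤ p × p ≤ i) P → length P ≤ j →
           CommutativeRing._≈_ R (lhsSum R t P j) (rhsProd R t P j)
lemma2p4 R t i j _ _ P sorted _ _ = begin
  lhsSum R t P j
    ≡⟨ cong (sumR R t) (sym (map-∘ (distinctTuples (length P) j))) ⟩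
  sumR R t (map (extensionWt R t [] P) (freshTuples [] (length P) j))
    ≈⟨ sum-extensionWt R t j P [] (Linked⇒AllPairs ℕ.<-trans sorted) [] [] [] ⟩
  rhsProd R t P j ∎
  where open import Relation.Binary.Reasoning.Setoid (CommutativeRing.setoid R)
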